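{- Let $\sigma$ be a unimodal vocabulary, $k>0$, and $(\mathcal{A},a),(\mathcal{B},b)$ pointed $\sigma$-structures. There is a bijective correspondence between winning strategies for Duplicator in the $k$-round existential hybrid game from $(\mathcal{A},a)$ to $(\mathcal{B},b)$ and coKleisli morphisms $h:\mathbb{H}^+_k(\mathcal{A},a)\to J(\mathcal{B},b)$.
   Context: A unimodal vocabulary consists of unary predicate symbols and one binary relation symbol $E$. A pointed structure is $(\mathcal{A},a)$ with $a\in A$; morphisms are homomorphisms preserving the point. Let $\sigma^+=\sigma\cup\{I\}$ with $I$ a new binary symbol. $J(\mathcal{B},b)$ is $(\mathcal{B},b)$ expanded to $\sigma^+$ with $I$ interpreted as the identity relation on $B$. $\mathbb{H}^+_k(\mathcal{A},a)$ is the pointed $\sigma^+$-structure whose universe is the set of sequences $\langle a_0,\ldots,a_l\rangle$ of elements of $A$ with $0\le l\le k$, $a_0=a$, and such that for each $0<j\le l$ there is $i<j$ with $E^{\mathcal{A}}(a_i,a_j)$; writing $\varepsilon(s)$ for the last element of $s$ and $s\sqsubseteq t$ for the prefix order, $P(s)$ holds iff $P^{\mathcal{A}}(\varepsilon(s))$ for unary $P$, $E(s,t)$ holds iff $s,t$ are $\sqsubseteq$-comparable and $E^{\mathcal{A}}(\varepsilon(s),\varepsilon(t))$, $I(s,t)$ holds iff $s,t$ are comparable and $\varepsilon(s)=\varepsilon(t)$; the distinguished element is $\langle a\rangle$. A coKleisli morphism is a $\sigma^+$-homomorphism $h:\mathbb{H}^+_k(\mathcal{A},a)\to J(\mathcal{B},b)$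 with $h(\langle a\rangle)=b$. The $k$-round existential hybrid game: in round $0$ Spoiler plays $a_0=a$ and Duplicator responds $b_0=b$; in each subsequent round $j=1,\ldots,k$ Spoiler chooses $a_j\in A$ such that $E^{\mathcal{A}}(a_i,a_j)$ for some $i<j$, and Duplicator responds with $b_j\in B$. Duplicator wins if the relation $\{(a_i,b_i)\}$ is a partial homomorphism from $\mathcal{A}$ to $\mathcal{B}$ (a well-defined partial function preserving all relations among the played elements). Strategies for Duplicator are functions assigning a response to each sequence of Spoiler moves. -}

module Defs where

open import Data.Nat using (ℕ; zero; suc; _≤_; _<_; z≤n)
open import Data.Fin using (Fin; toℕ; fromℕ) renaming (zero to fzero)
open import Data.Product using (Σ; _×_; _,_; ∃-syntax)
open import Data.Sum using (_⊎_)
open import Data.Empty using (⊥-elim)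
open import Relation.Binary.PropositionalEquality using (_≡_; refl; sym; trans)
open import Relation.Binary.Bundles using (Setoid)
open import Relation.Binary.Structures using (IsEquivalence)
open import Data.Nat.Properties using (<-irrefl)

-- Unimodal vocabulary σ: a set U of unary predicate symbols together
-- with one binary relation symbol E.  A σ-structure:

record Structure (U : Set) : Set₁ where
  field
    Carrier : Set
    E       : Carrier → Carrier → Set
    P       : U → Carrier → Set

record Pointed (U : Set) : Set₁ where
  field
    struct : Structure U
    point  : Structure.Carrier struct

record Structure⁺ (U : Set) : Set₁ where
  field
    Carrier : Set
    E       : Carrier → Carrier → Set
    I       : Carrier → Carrier → Set
    P       : U → Carrier → Set

record Pointed⁺ (U : Set) : Set₁ where
  field
    struct : Structure⁺ U
    point  : Structure⁺.Carrier struct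

J : {U : Set} → Pointed U → Pointed⁺ U
J 𝔅 = record
  { struct = record { Carrier = Carrier ; E = E ; I = _≡_ ; P = P }
  ; point  = Pointed.point 𝔅 }
  where open Structure (Pointed.struct 𝔅)

module _ {U : Set} (𝔄 : Pointed U) (k : ℕ) where
  open Pointed 𝔄 renaming (point to a)
  open Structure struct

  record Seq : Set where
    field
      len    : ℕ
      len≤k  : len ≤ k
      elems  : Fin (suc len) → Carrier
      starts : elems fzero ≡ a
      legal  : (j : Fin (suc len)) → 0 < toℕ j →
               ∃[ i ] (toℕ i < toℕ j × E (elems i) (elems j))

  ε : Seq → Carrier
  ε s = Seq.elems s (fromℕ (Seq.len s))

  _⊑_ : Seq → Seq → Set
  s ⊑ t = Seq.len s ≤ Seq.len t ×
          ((i : Fin (suc (Seq.len s))) (j : Fin (suc (Seq.len t))) →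
             toℕ i ≡ toℕ j → Seq.elems s i ≡ Seq.elems t j)

  Comparable : Seq → Seq → Set
  Comparable s t = s ⊑ t ⊎ t ⊑ s

  ⟨a⟩ : Seq
  ⟨a⟩ = record
    { len = 0 ; len≤k = z≤n ; elems = λ _ → a ; starts = refl
    ; legal = λ { fzero () } }

  H⁺ : Pointed⁺ U
  H⁺ = record
    { struct = record
        { Carrier = Seq
        ; E = λ s t → Comparable s t × E (ε s) (ε t)
        ; I = λ s t → Comparable s t × ε s ≡ ε t
        ; P = λ u s → P u (ε s) }
    ; point = ⟨a⟩ }

record Hom⁺ {U : Set} (𝔖 𝔗 : Pointed⁺ U) : Set where
  private
    module S = Structure⁺ (Pointed⁺.struct 𝔖)
    module T = Structure⁺ (Pointed⁺.struct 𝔗)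
  field
    fun    : S.Carrier → T.Carrier
    pres-E : ∀ x y → S.E x y → T.E (fun x) (fun y)
    pres-I : ∀ x y → S.I x y → T.I (fun x) (fun y)
    pres-P : ∀ u x → S.P u x → T.P u (fun x)
    pres-pt : fun (Pointed⁺.point 𝔖) ≡ Pointed⁺.point 𝔗

CoKleisli : {U : Set} (k : ℕ) (𝔄 𝔅 : Pointed U) → Set
CoKleisli k 𝔄 𝔅 = Hom⁺ (H⁺ 𝔄 k) (J 𝔅)

-- The sequences of Spoiler moves a₀ = a, a₁, …, a_j (j ≤ k) are exactly
-- the elements of Seq 𝔄 k.

module _ {U : Set} (k : ℕ) (𝔄 𝔅 : Pointed U) where
  private
    module A = Structure (Pointed.struct 𝔄)
    module B = Structure (Pointed.struct 𝔅)

  record Strategy : Set where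
    field
      respond  : Seq 𝔄 k → B.Carrier
      round0   : respond (⟨a⟩ 𝔄 k) ≡ Pointed.point 𝔅

  -- After the play t (any sequence of Spoiler moves), the played pairs
  -- are (a_i , b_i) = (ε p , respond p) for the prefixes p ⊑ t.  Duplicator
  -- wins if this relation is a partial homomorphism 𝔄 ⇀ 𝔅.
  IsPartialHomAfter : Strategy → Seq 𝔄 k → Set
  IsPartialHomAfter S t =
    ((p q : Seq 𝔄 k) → _⊑_ 𝔄 k p t → _⊑_ 𝔄 k q t →
       ε 𝔄 k p ≡ ε 𝔄 k q → respond p ≡ respond q) ×
    ((p q : Seq 𝔄 k) → _⊑_ 𝔄 k p t → _⊑_ 𝔄 k q t →
       A.E (ε 𝔄 k p) (ε 𝔄 k q) → B.E (respond p) (respond q)) ×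
    ((u : U) (p : Seq 𝔄 k) → _⊑_ 𝔄 k p t →
       A.P u (ε 𝔄 k p) → B.P u (respond p))
    where open Strategy S

  IsWinning : Strategy → Set
  IsWinning S = (t : Seq 𝔄 k) → IsPartialHomAfter S t

  WinningStrategy : Set
  WinningStrategy = Σ Strategy IsWinning

  -- Setoids: strategies / morphisms are identified when they agree
  -- pointwise (function extensionality is not available in --safe Agda).
  WinningStrategySetoid : Setoid _ _
  WinningStrategySetoid = record
    { Carrier = WinningStrategy
    ; _≈_ = λ S T → (s : Seq 𝔄 k) →
              Strategy.respond (Σ.proj₁ S) s ≡ Strategy.respond (Σ.proj₁ T) s
    ; isEquivalence = record
        { refl = λ _ → refl
        ; sym = λ e s → sym (e s)
        ; trans = λ e f s → trans (e s) (f s) } }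

  CoKleisliSetoid : Setoid _ _
  CoKleisliSetoid = record
    { Carrier = CoKleisli k 𝔄 𝔅
    ; _≈_ = λ h g → (s : Seq 𝔄 k) → Hom⁺.fun h s ≡ Hom⁺.fun g s
    ; isEquivalence = record
        { refl = λ _ → refl
        ; sym = λ e s → sym (e s)
        ; trans = λ e f s → trans (e s) (f s) } }

{-# OPTIONS --safe #-}
module Submission where

-- A Duplicator strategy and a coKleisli morphism are both functions on the
-- plays Seq 𝔄 k, each sending ⟨a⟩ to b.  Winning after a play t only
-- constrains pairs of prefixes of t, and any two prefixes of t are
-- comparable; conversely any two comparable plays are prefixes of the longer
-- one.  So "partial homomorphism after every play" is precisely "preserves
-- E, I and P on comparable pairs", i.e. being a σ⁺-homomorphism into J(𝔅),
-- and both translations keep the underlying function unchanged.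

open import Defs
open import Data.Nat using (ℕ; _<_; _≤_; s≤s)
open import Data.Nat.Properties using (≤-refl; ≤-trans; ≤-total)
open import Data.Fin using (Fin; toℕ; fromℕ<)
open import Data.Fin.Properties using (toℕ<n; toℕ-fromℕ<; toℕ-injective)
open import Data.Product using (Σ; proj₁; _,_; _×_)
open import Data.Sum using (inj₁; inj₂)
open import Relation.Binary.PropositionalEquality using (_≡_; refl; sym; trans; cong)
open import Function.Bundles using (Inverse)

module _ {U : Set} (𝔄 : Pointed U) (k : ℕ) where
  open Seq

  private
    _⊑ₖ_ : Seq 𝔄 k → Seq 𝔄 k → Set
    _⊑ₖ_ = _⊑_ 𝔄 k

  ⊑-refl : (s : Seq 𝔄 k) → s ⊑ₖ s
  ⊑-refl s = ≤-refl , λ i j i≡j → cong (elems s) (toℕ-injective i≡j)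

  -- Both p and q agree with t at each position of q, read off in t.
  prefixes-≤-len⇒⊑ : (p q t : Seq 𝔄 k) → p ⊑ₖ t → q ⊑ₖ t →
                     len p ≤ len q → p ⊑ₖ q
  prefixes-≤-len⇒⊑ _ _ _ (_ , p≈t) (q≤t , q≈t) p≤q = p≤q , λ i j i≡j →
    let j<t  = ≤-trans (toℕ<n j) (s≤s q≤t)
        j′   = fromℕ< j<t
        j′≡j = toℕ-fromℕ< j<t
    in trans (p≈t i j′ (trans i≡j (sym j′≡j))) (sym (q≈t j j′ (sym j′≡j)))

  prefixes-comparable : (p q t : Seq 𝔄 k) → p ⊑ₖ t → q ⊑ₖ t → Comparable 𝔄 k p q
  prefixes-comparable p q t p⊑t q⊑t with ≤-total (len p) (len q)
  ... | inj₁ p≤q = inj₁ (prefixes-≤-len⇒⊑ p q t p⊑t q⊑t p≤q)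
  ... | inj₂ q≤p = inj₂ (prefixes-≤-len⇒⊑ q p t q⊑t p⊑t q≤p)

  comparable⇒common-extension : (p q : Seq 𝔄 k) → Comparable 𝔄 k p q →
                                Σ (Seq 𝔄 k) λ t → p ⊑ₖ t × q ⊑ₖ t
  comparable⇒common-extension _ q (inj₁ p⊑q) = q , p⊑q , ⊑-refl q
  comparable⇒common-extension p _ (inj₂ q⊑p) = p , ⊑-refl p , q⊑p

module _ {U : Set} (k : ℕ) (𝔄 𝔅 : Pointed U) where
  winning⇒coKleisli : WinningStrategy k 𝔄 𝔅 → CoKleisli k 𝔄 𝔅
  winning⇒coKleisli (S , winning) = record
    { fun     = respond
    ; pres-E  = λ p q (p~q , e) → let t , p⊑t , q⊑t = extend p q p~q
                                      _ , pres-E , _ = winning t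
                                  in pres-E p q p⊑t q⊑t e
    ; pres-I  = λ p q (p~q , e) → let t , p⊑t , q⊑t = extend p q p~q
                                      pres-I , _ = winning t
                                  in pres-I p q p⊑t q⊑t e
    ; pres-P  = λ u p Pp → let _ , _ , pres-P = winning p
                           in pres-P u p (⊑-refl 𝔄 k p) Pp
    ; pres-pt = round0
    }
    where
    open Strategy S

    extend : (p q : Seq 𝔄 k) → Comparable 𝔄 k p q →
             Σ (Seq 𝔄 k) λ t → _⊑_ 𝔄 k p t × _⊑_ 𝔄 k q t
    extend = comparable⇒common-extension 𝔄 k

  coKleisli⇒winning : CoKleisli k 𝔄 𝔅 → WinningStrategy k 𝔄 𝔅
  coKleisli⇒winning h =
    record { respond = fun ; round0 = pres-pt } ,
    λ t → (λ p q p⊑t q⊑t e → pres-I p q (prefixes-comparable 𝔄 k p q t p⊑t q⊑t , e))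
        , (λ p q p⊑t q⊑t e → pres-E p q (prefixes-comparable 𝔄 k p q t p⊑t q⊑t , e))
        , (λ u p _ Pp → pres-P u p Pp)
    where open Hom⁺ h

mainTheorem14 : {U : Set} (k : ℕ) → 0 < k → (𝔄 𝔅 : Pointed U) →
    Σ (Inverse (WinningStrategySetoid k 𝔄 𝔅) (CoKleisliSetoid k 𝔄 𝔅))
    (λ F → (S : WinningStrategy k 𝔄 𝔅) (s : Seq 𝔄 k) →
    Hom⁺.fun (Inverse.to F S) s ≡ Strategy.respond (proj₁ S) s)
mainTheorem14 k _ 𝔄 𝔅 = correspondence , λ _ _ → refl
  where
  correspondence : Inverse (WinningStrategySetoid k 𝔄 𝔅) (CoKleisliSetoid k 𝔄 𝔅)
  correspondence = record
    { to        = winning⇒coKleisli k 𝔄 𝔅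
    ; from      = coKleisli⇒winning k 𝔄 𝔅
    ; to-cong   = λ same-responses → same-responses
    ; from-cong = λ same-functions → same-functions
    ; inverse   = (λ agree → agree) , (λ agree → agree)
    }
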